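{- Let $n\ge2$, let $p$ be a prime and $m\ge0$. With $a_n$ and $a'_n$ as defined in the context, \[a'_n(p^m)=\sum_{i=0}^m(-1)^i\binom{n}{i}a_n(p^{m-i}).\]
   Context: For positive integers $k$ define $a_n(k)=\sum_{d_1\cdots d_n=k}d_1^0d_2^1\cdots d_n^{n-1}$ and $a'_n(k)=\sum_{d_1\cdots d_n=k}\prod_{i=1}^n\sum_{g\mid d_i}\mu(g)(d_i/g)^{i-1}$, the sums running over tuples of positive integers with product $k$ and $\mu$ the Möbius function. Equivalently, $a_n(k)$ is the number of integer $n\times n$ matrices in lower Hermite normal form (lower triangular with $c_{ii}>0$ and $0\le c_{ij}<c_{ii}$ for $j<i$) with determinant $k$, and $a'_n(k)$ is the number of those whose rows are all primitive vectors. The binomial coefficient $\binom{n}{i}$ is $0$ for $i>n$. -}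

module Defs where

open import Data.Nat as ℕ using (ℕ; zero; suc; _≡ᵇ_)
open import Data.Nat.Divisibility using (_∣?_)
open import Data.Nat.Primality using (prime?)
open import Data.Integer as ℤ using (ℤ; +_; -_)
open import Data.List using (List; []; _∷_; map; concatMap; filter; length; upTo; foldr)
open import Data.Bool using (if_then_else_)
open import Relation.Nullary.Decidable using (_×-dec_; ⌊_⌋)

sumℤ : List ℤ → ℤ
sumℤ = foldr ℤ._+_ (+ 0)

range1 : ℕ → List ℕ
range1 k = map suc (upTo k)

sumPairs : ℕ → (ℕ → ℕ → ℤ) → ℤ
sumPairs k f =
  sumℤ (concatMap (λ d → concatMap (λ e →
         if (d ℕ.* e) ≡ᵇ k then f d e ∷ [] else []) (range1 k)) (range1 k))

μ : ℕ → ℤ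
μ g with filter (λ p → prime? p ×-dec ((p ℕ.* p) ∣? g)) (upTo (suc g))
... | _ ∷ _ = + 0
... | [] = (- + 1) ℤ.^ length (filter (λ p → prime? p ×-dec (p ∣? g)) (upTo (suc g)))

-- Sum over all tuples (d_1,...,d_n) of positive integers with
-- d_1 ⋯ d_n ≡ k of  f j d_1 * f (j+1) d_2 * ... * f (j+n-1) d_n.
sumTuples : (ℕ → ℕ → ℤ) → ℕ → ℕ → ℕ → ℤ
sumTuples f j zero k = if k ≡ᵇ 1 then + 1 else + 0
sumTuples f j (suc n) k = sumPairs k (λ d e → f j d ℤ.* sumTuples f (suc j) n e)

-- a_n(k) = Σ_{d_1⋯d_n = k} d_1^0 d_2^1 ⋯ d_n^(n-1)   (index j = i-1)
a : ℕ → ℕ → ℤ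
a n k = sumTuples (λ j d → + (d ℕ.^ j)) 0 n k

-- Σ_{g ∣ d} μ(g) (d/g)^j, written as a sum over factorisations d = g * e
primFactor : ℕ → ℕ → ℤ
primFactor j d = sumPairs d (λ g e → μ g ℤ.* + (e ℕ.^ j))

-- a'_n(k) = Σ_{d_1⋯d_n = k} ∏_i Σ_{g ∣ d_i} μ(g) (d_i/g)^(i-1)
a' : ℕ → ℕ → ℤ
a' n k = sumTuples primFactor 0 n k

{-# OPTIONS --safe #-}

-- On powers of a prime p a sum over factorisations d e = p^m is a Cauchy product
-- Σ_{i ≤ m} x(i) y(m − i) of sequences in the exponent, so m ↦ a_n(p^m) and
-- m ↦ a'_n(p^m) are n-fold Cauchy products. The local factor of a'_n is
-- Σ_{g ∣ p^i} μ(g) (p^i/g)^j = p^{ij} − p^{(i−1)j}, the backward difference Δ of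
-- i ↦ p^{ij}. As Δ commutes with Cauchy products, m ↦ a'_n(p^m) is Δⁿ of
-- m ↦ a_n(p^m), and by Pascal's rule Δⁿ is the Cauchy product with (−1)^i C(n,i).

module Submission where

open import Defs
open import Data.Nat using (ℕ; suc; _≤_; _^_; _∸_)
open import Data.Nat.Primality using (Prime)
open import Data.Nat.Combinatorics using (_C_)
open import Data.Integer using (ℤ; +_; -_; _*_)
open import Data.List using (map; upTo)
open import Relation.Binary.PropositionalEquality using (_≡_)

open import Data.Bool using (Bool; true; false; if_then_else_; T)
open import Data.Empty using (⊥-elim)
open import Data.Fin using (toℕ)
open import Data.Fin.Properties using (toℕ<n; toℕ-inject₁; toℕ-fromℕ)
import Data.Integer as ℤ
open import Data.Integer using (_+_; _-_)
import Data.Integer.Properties as ℤP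
open import Data.Integer.Tactic.RingSolver using (solve-∀)
open import Data.List using (List; []; _∷_; _++_; applyUpTo; concatMap; filter; length)
import Data.List.Properties as LP
open import Data.List.Membership.Propositional.Properties using (∈-filter⁺; ∈-upTo⁺)
import Data.List.Relation.Unary.All as All
import Data.List.Relation.Unary.All.Properties as AllP
open import Data.Nat as ℕ using (zero; _<_; _≡ᵇ_; z≤n; s≤s; z<s; s<s; pred; NonZero; nonTrivial⇒n>1)
import Data.Nat.Properties as ℕP
open import Data.Nat.Properties using (≡ᵇ⇒≡; ≡⇒≡ᵇ)
open import Data.Nat.Combinatorics using (nCk+nC[k+1]≡[n+1]C[k+1])
open import Data.Nat.Coprimality using (Coprime; coprime-divisor)
open import Data.Nat.Divisibility
  using (_∣_; _∣?_; divides; ∣⇒≤; ∣-trans; ∣-refl; m∣m*n; ∣1⇒≡1; *-cancelˡ-∣)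
open import Data.Nat.Primality
  using (prime?; prime⇒nonZero; prime⇒nonTrivial; prime⇒irreducible; ¬prime[1])
open import Data.Product using (_×_; _,_; ∃-syntax)
open import Data.Sum using (inj₁; inj₂)
open import Function using (id; _∘_)
open import Relation.Binary.Definitions using (tri<; tri≈; tri>)
open import Relation.Binary.PropositionalEquality
  using (_≢_; _≗_; refl; sym; trans; cong; cong₂; subst; module ≡-Reasoning)
open import Relation.Nullary using (¬_; yes; no)
open import Relation.Nullary.Decidable using (_×-dec_)
open import Relation.Unary using (Decidable)

open import Algebra.Properties.CommutativeMonoid.Sum ℤP.+-0-commutativeMonoid
  using (sum; sum-cong-≗; sum-replicate-zero; sum-init-last; ∑-distrib-+; ∑-comm)

∑ : ℕ → (ℕ → ℤ) → ℤ
∑ n f = sum {n} (f ∘ toℕ)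

∑-cong : ∀ n {f g : ℕ → ℤ} → (∀ i → i < n → f i ≡ g i) → ∑ n f ≡ ∑ n g
∑-cong n f≡g = sum-cong-≗ {n} (λ i → f≡g (toℕ i) (toℕ<n i))

∑-zero : ∀ n {f : ℕ → ℤ} → (∀ i → i < n → f i ≡ + 0) → ∑ n f ≡ + 0
∑-zero n f≡0 = trans (∑-cong n f≡0) (sum-replicate-zero n)

∑-last : ∀ n (f : ℕ → ℤ) → ∑ (suc n) f ≡ ∑ n f + f n
∑-last n f = trans (sum-init-last {n} (f ∘ toℕ))
  (cong₂ _+_ (sum-cong-≗ {n} (cong f ∘ toℕ-inject₁)) (cong f (toℕ-fromℕ n)))

∑-neg : ∀ n (f : ℕ → ℤ) → ∑ n (λ i → - f i) ≡ - ∑ n f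
∑-neg zero f = refl
∑-neg (suc n) f = trans (cong (_+_ (- f 0)) (∑-neg n (f ∘ suc)))
  (sym (ℤP.neg-distrib-+ (f 0) (∑ n (f ∘ suc))))

∑-distrib-- : ∀ n (f g : ℕ → ℤ) → ∑ n (λ i → f i - g i) ≡ ∑ n f - ∑ n g
∑-distrib-- n f g = trans (∑-distrib-+ {n} (f ∘ toℕ) (λ i → - g (toℕ i)))
  (cong (_+_ (∑ n f)) (∑-neg n g))

∑-swap : ∀ m n (F : ℕ → ℕ → ℤ) → ∑ m (λ i → ∑ n (F i)) ≡ ∑ n (λ j → ∑ m (λ i → F i j))
∑-swap m n F = ∑-comm {m} {n} (λ i j → F (toℕ i) (toℕ j))

∑-single : ∀ n (f : ℕ → ℤ) {x} → x < n → (∀ i → i < n → i ≢ x → f i ≡ + 0) → ∑ n f ≡ f x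
∑-single (suc n) f {zero} _ f≡0 =
  trans (cong (_+_ (f 0)) (∑-zero n (λ i i<n → f≡0 (suc i) (s<s i<n) λ ())))
        (ℤP.+-identityʳ (f 0))
∑-single (suc n) f {suc x} (s<s x<n) f≡0 =
  trans (cong₂ _+_ (f≡0 0 z<s λ ())
                   (∑-single n (f ∘ suc) x<n (λ i i<n i≢x → f≡0 (suc i) (s<s i<n) (i≢x ∘ cong pred))))
        (ℤP.+-identityˡ (f (suc x)))

if-T : ∀ b {x : ℤ} → T b → (if b then x else + 0) ≡ x
if-T true _ = refl

if-¬T : ∀ b {x : ℤ} → ¬ T b → (if b then x else + 0) ≡ + 0
if-¬T true ¬b = ⊥-elim (¬b _)
if-¬T false _ = refl

∑-if-unique : ∀ n (b : ℕ → Bool) (f : ℕ → ℤ) {x} → x < n → T (b x) → (∀ i → T (b i) → i ≡ x) →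
  ∑ n (λ i → if b i then f i else + 0) ≡ f x
∑-if-unique n b f {x} x<n bx unique =
  trans (∑-single n _ x<n (λ i _ i≢x → if-¬T (b i) (i≢x ∘ unique i))) (if-T (b x) bx)

∑-if-none : ∀ n (b : ℕ → Bool) (f : ℕ → ℤ) → (∀ i → i < n → ¬ T (b i)) →
  ∑ n (λ i → if b i then f i else + 0) ≡ + 0
∑-if-none n b f ¬b = ∑-zero n (λ i i<n → if-¬T (b i) {f i} (¬b i i<n))

sumℤ-++ : ∀ xs ys → sumℤ (xs ++ ys) ≡ sumℤ xs + sumℤ ys
sumℤ-++ [] ys = sym (ℤP.+-identityˡ (sumℤ ys))
sumℤ-++ (x ∷ xs) ys = trans (cong (_+_ x) (sumℤ-++ xs ys)) (sym (ℤP.+-assoc x (sumℤ xs) (sumℤ ys)))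

sumℤ-concatMap : ∀ {A : Set} (G : A → List ℤ) xs → sumℤ (concatMap G xs) ≡ sumℤ (map (sumℤ ∘ G) xs)
sumℤ-concatMap G [] = refl
sumℤ-concatMap G (x ∷ xs) =
  trans (sumℤ-++ (G x) (concatMap G xs)) (cong (_+_ (sumℤ (G x))) (sumℤ-concatMap G xs))

sumℤ-map-applyUpTo : ∀ (f : ℕ → ℤ) (g : ℕ → ℕ) n → sumℤ (map f (applyUpTo g n)) ≡ ∑ n (f ∘ g)
sumℤ-map-applyUpTo f g zero = refl
sumℤ-map-applyUpTo f g (suc n) = cong (_+_ (f (g 0))) (sumℤ-map-applyUpTo f (g ∘ suc) n)

sumℤ-map-upTo : ∀ (f : ℕ → ℤ) n → sumℤ (map f (upTo n)) ≡ ∑ n f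
sumℤ-map-upTo f = sumℤ-map-applyUpTo f id

sumℤ-concatMap-range1 : ∀ (G : ℕ → List ℤ) n → sumℤ (concatMap G (range1 n)) ≡ ∑ n (sumℤ ∘ G ∘ suc)
sumℤ-concatMap-range1 G n = begin
  sumℤ (concatMap G (map suc (upTo n)))    ≡⟨ sumℤ-concatMap G (map suc (upTo n)) ⟩
  sumℤ (map (sumℤ ∘ G) (map suc (upTo n))) ≡⟨ cong sumℤ (LP.map-∘ (upTo n)) ⟨
  sumℤ (map (sumℤ ∘ G ∘ suc) (upTo n))     ≡⟨ sumℤ-map-upTo (sumℤ ∘ G ∘ suc) n ⟩
  ∑ n (sumℤ ∘ G ∘ suc)                     ∎
  where open ≡-Reasoning

sumPairs-∑∑ : ∀ k (f : ℕ → ℕ → ℤ) →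
  sumPairs k f ≡ ∑ k (λ d → ∑ k (λ e → if (suc d ℕ.* suc e) ≡ᵇ k then f (suc d) (suc e) else + 0))
sumPairs-∑∑ k f = trans (sumℤ-concatMap-range1 _ k) (∑-cong k (λ d _ →
  trans (sumℤ-concatMap-range1 (λ e → if (suc d ℕ.* e) ≡ᵇ k then f (suc d) e ∷ [] else []) k)
        (∑-cong k (λ e _ → sumℤ-singleton-if ((suc d ℕ.* suc e) ≡ᵇ k) {f (suc d) (suc e)}))))
  where
  sumℤ-singleton-if : ∀ b {x} → sumℤ (if b then x ∷ [] else []) ≡ (if b then x else + 0)
  sumℤ-singleton-if true = ℤP.+-identityʳ _
  sumℤ-singleton-if false = refl

infixl 7 _⋆_

_⋆_ : (ℕ → ℤ) → (ℕ → ℤ) → ℕ → ℤ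
(A ⋆ B) m = ∑ (suc m) (λ i → A i * B (m ∸ i))

⋆-cong : ∀ {A A' B B' : ℕ → ℤ} → A ≗ A' → B ≗ B' → A ⋆ B ≗ A' ⋆ B'
⋆-cong A≗A' B≗B' m = ∑-cong (suc m) (λ i _ → cong₂ _*_ (A≗A' i) (B≗B' (m ∸ i)))

Δ : (ℕ → ℤ) → ℕ → ℤ
Δ B zero = B 0
Δ B (suc m) = B (suc m) - B m

Δ-cong : ∀ {B B' : ℕ → ℤ} → B ≗ B' → Δ B ≗ Δ B'
Δ-cong B≗B' zero = B≗B' 0
Δ-cong B≗B' (suc m) = cong₂ _-_ (B≗B' (suc m)) (B≗B' m)

Δ-⋆ˡ : ∀ A B → Δ A ⋆ B ≗ Δ (A ⋆ B)
Δ-⋆ˡ A B zero = refl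
Δ-⋆ˡ A B (suc k) = begin
  A 0 * B (suc k) + ∑ (suc k) (λ i → (A (suc i) - A i) * B (k ∸ i))
    ≡⟨ cong (_+_ (A 0 * B (suc k))) split ⟩
  A 0 * B (suc k) + (X - Y)
    ≡⟨ ℤP.+-assoc (A 0 * B (suc k)) X (- Y) ⟨
  A 0 * B (suc k) + X - Y
    ∎
  where
  open ≡-Reasoning
  X Y : ℤ
  X = ∑ (suc k) (λ i → A (suc i) * B (k ∸ i))
  Y = (A ⋆ B) k
  *-distribʳ-- : ∀ a b c → (a - b) * c ≡ a * c - b * c
  *-distribʳ-- = solve-∀
  split : ∑ (suc k) (λ i → (A (suc i) - A i) * B (k ∸ i)) ≡ X - Y
  split = trans (∑-cong (suc k) (λ i _ → *-distribʳ-- (A (suc i)) (A i) (B (k ∸ i))))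
                (∑-distrib-- (suc k) (λ i → A (suc i) * B (k ∸ i)) (λ i → A i * B (k ∸ i)))

Δ-⋆ʳ : ∀ A B → A ⋆ Δ B ≗ Δ (A ⋆ B)
Δ-⋆ʳ A B zero = refl
Δ-⋆ʳ A B (suc k) = begin
  (A ⋆ Δ B) (suc k)
    ≡⟨ ∑-last (suc k) (λ i → A i * Δ B (suc k ∸ i)) ⟩
  ∑ (suc k) (λ i → A i * Δ B (suc k ∸ i)) + A (suc k) * Δ B (k ∸ k)
    ≡⟨ cong₂ _+_ (trans (∑-cong (suc k) (λ i i≤k → *-Δ-suc∸ i (ℕP.≤-pred i≤k)))
                        (∑-distrib-- (suc k) (λ i → A i * B (suc k ∸ i)) (λ i → A i * B (k ∸ i))))
                 (cong (λ j → A (suc k) * Δ B j) (ℕP.n∸n≡0 k)) ⟩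
  (X - Y) + A (suc k) * B 0
    ≡⟨ swap X Y (A (suc k) * B 0) ⟩
  (X + A (suc k) * B 0) - Y
    ≡⟨ cong (λ j → (X + A (suc k) * B j) - Y) (ℕP.n∸n≡0 k) ⟨
  (X + A (suc k) * B (k ∸ k)) - Y
    ≡⟨ cong (_- Y) (∑-last (suc k) (λ i → A i * B (suc k ∸ i))) ⟨
  (A ⋆ B) (suc k) - Y
    ∎
  where
  open ≡-Reasoning
  X Y : ℤ
  X = ∑ (suc k) (λ i → A i * B (suc k ∸ i))
  Y = (A ⋆ B) k
  *-distribˡ-- : ∀ a b c → a * (b - c) ≡ a * b - a * c
  *-distribˡ-- = solve-∀
  *-Δ-suc∸ : ∀ i → i ≤ k → A i * Δ B (suc k ∸ i) ≡ A i * B (suc k ∸ i) - A i * B (k ∸ i)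
  *-Δ-suc∸ i i≤k rewrite ℕP.+-∸-assoc 1 i≤k = *-distribˡ-- (A i) (B (suc (k ∸ i))) (B (k ∸ i))
  swap : ∀ x y z → (x - y) + z ≡ (x + z) - y
  swap = solve-∀

Δ^ : ℕ → (ℕ → ℤ) → ℕ → ℤ
Δ^ zero B = B
Δ^ (suc n) B = Δ (Δ^ n B)

Δ^-cong : ∀ n {B B' : ℕ → ℤ} → B ≗ B' → Δ^ n B ≗ Δ^ n B'
Δ^-cong zero B≗B' = B≗B'
Δ^-cong (suc n) B≗B' = Δ-cong (Δ^-cong n B≗B')

Δ^-⋆ʳ : ∀ n A B → A ⋆ Δ^ n B ≗ Δ^ n (A ⋆ B)
Δ^-⋆ʳ zero A B m = refl
Δ^-⋆ʳ (suc n) A B m = trans (Δ-⋆ʳ A (Δ^ n B) m) (Δ-cong (Δ^-⋆ʳ n A B) m)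

signedBinomial : ℕ → ℕ → ℤ
signedBinomial n i = (- + 1) ℤ.^ i * + (n C i)

Δ-signedBinomial : ∀ n → Δ (signedBinomial n) ≗ signedBinomial (suc n)
Δ-signedBinomial n zero = refl
Δ-signedBinomial n (suc k) = begin
  (- + 1) ℤ.^ suc k * + (n C suc k) - (- + 1) ℤ.^ k * + (n C k)
    ≡⟨ pull-sign ((- + 1) ℤ.^ k) (+ (n C k)) (+ (n C suc k)) ⟩
  (- + 1) ℤ.^ suc k * (+ (n C k) + + (n C suc k))
    ≡⟨ cong (λ c → (- + 1) ℤ.^ suc k * c) (ℤP.pos-+ (n C k) (n C suc k)) ⟨
  (- + 1) ℤ.^ suc k * + (n C k ℕ.+ n C suc k)
    ≡⟨ cong (λ c → (- + 1) ℤ.^ suc k * + c) (nCk+nC[k+1]≡[n+1]C[k+1] n k) ⟩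
  (- + 1) ℤ.^ suc k * + (suc n C suc k)
    ∎
  where
  open ≡-Reasoning
  pull-sign : ∀ s x y → (- + 1) * s * y - s * x ≡ (- + 1) * s * (x + y)
  pull-sign = solve-∀

signedBinomial-0-⋆ : ∀ B → signedBinomial 0 ⋆ B ≗ B
signedBinomial-0-⋆ B m = begin
  + 1 * + 1 * B m + ∑ m (λ i → signedBinomial 0 (suc i) * B (m ∸ suc i))
    ≡⟨ cong₂ _+_ (ℤP.*-identityˡ (B m)) (∑-zero m (λ i _ → vanishes i)) ⟩
  B m + + 0
    ≡⟨ ℤP.+-identityʳ (B m) ⟩
  B m
    ∎
  where
  open ≡-Reasoning
  vanishes : ∀ i → signedBinomial 0 (suc i) * B (m ∸ suc i) ≡ + 0
  vanishes i = trans (cong (_* B (m ∸ suc i)) (ℤP.*-zeroʳ ((- + 1) ℤ.^ suc i))) (ℤP.*-zeroˡ (B (m ∸ suc i)))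

Δ^≗signedBinomial-⋆ : ∀ n B → Δ^ n B ≗ signedBinomial n ⋆ B
Δ^≗signedBinomial-⋆ zero B m = sym (signedBinomial-0-⋆ B m)
Δ^≗signedBinomial-⋆ (suc n) B m = begin
  Δ (Δ^ n B) m                    ≡⟨ Δ-cong (Δ^≗signedBinomial-⋆ n B) m ⟩
  Δ (signedBinomial n ⋆ B) m      ≡⟨ Δ-⋆ˡ (signedBinomial n) B m ⟨
  (Δ (signedBinomial n) ⋆ B) m    ≡⟨ ⋆-cong {B = B} (Δ-signedBinomial n) (λ _ → refl) m ⟩
  (signedBinomial (suc n) ⋆ B) m  ∎
  where open ≡-Reasoning

μ-non-squarefree : ∀ {q g} .{{_ : NonZero g}} → Prime q → q ℕ.* q ∣ g → μ g ≡ + 0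
μ-non-squarefree {q} {g} q-prime q²∣g
  with filter (λ p → prime? p ×-dec ((p ℕ.* p) ∣? g)) (upTo (suc g))
     | ∈-filter⁺ (λ p → prime? p ×-dec ((p ℕ.* p) ∣? g))
                 (∈-upTo⁺ (s≤s (ℕP.≤-trans (ℕP.m≤m*n q q {{prime⇒nonZero q-prime}}) (∣⇒≤ q²∣g))))
                 (q-prime , q²∣g)
... | _ ∷ _ | _ = refl

μ-squarefree : ∀ g → (∀ q → ¬ (Prime q × q ℕ.* q ∣ g)) →
  μ g ≡ (- + 1) ℤ.^ length (filter (λ q → prime? q ×-dec (q ∣? g)) (upTo (suc g)))
μ-squarefree g squarefree
  with filter (λ p → prime? p ×-dec ((p ℕ.* p) ∣? g)) (upTo (suc g))
     | LP.filter-none (λ p → prime? p ×-dec ((p ℕ.* p) ∣? g)) (All.universal squarefree (upTo (suc g)))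
... | [] | _ = refl

primeDivisors-prime : ∀ {p} → Prime p → filter (λ q → prime? q ×-dec (q ∣? p)) (upTo (suc p)) ≡ p ∷ []
primeDivisors-prime {p} p-prime = begin
  filter P? (upTo (suc p))                 ≡⟨ cong (filter P?) (LP.upTo-∷ʳ p) ⟨
  filter P? (upTo p ++ p ∷ [])             ≡⟨ LP.filter-++ P? (upTo p) (p ∷ []) ⟩
  filter P? (upTo p) ++ filter P? (p ∷ []) ≡⟨ cong₂ _++_ none-below-p (LP.filter-accept P? (p-prime , ∣-refl)) ⟩
  p ∷ []                                   ∎
  where
  open ≡-Reasoning
  P? : Decidable (λ q → Prime q × q ∣ p)
  P? q = prime? q ×-dec (q ∣? p)
  smaller-not-prime-divisor : ∀ {q} → q < p → ¬ (Prime q × q ∣ p)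
  smaller-not-prime-divisor q<p (q-prime , q∣p) with prime⇒irreducible p-prime q∣p
  ... | inj₁ refl = ¬prime[1] q-prime
  ... | inj₂ refl = ℕP.<-irrefl refl q<p
  none-below-p : filter P? (upTo p) ≡ []
  none-below-p = LP.filter-none P? (All.map smaller-not-prime-divisor (AllP.all-upTo p))

μ-prime : ∀ {p} → Prime p → μ p ≡ - + 1
μ-prime {p} p-prime = trans (μ-squarefree p no-square-divisor)
                            (cong (λ ps → (- + 1) ℤ.^ length ps) (primeDivisors-prime p-prime))
  where
  no-square-divisor : ∀ q → ¬ (Prime q × q ℕ.* q ∣ p)
  no-square-divisor q (q-prime , q²∣p) with prime⇒irreducible p-prime (∣-trans (m∣m*n {q} q) q²∣p)
  ... | inj₁ refl = ¬prime[1] q-prime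
  ... | inj₂ refl = ¬prime[1] (subst Prime (∣1⇒≡1 q∣1) q-prime)
    where
    q∣1 : q ∣ 1
    q∣1 = *-cancelˡ-∣ q {{prime⇒nonZero q-prime}} (subst (q ℕ.* q ∣_) (sym (ℕP.*-identityʳ q)) q²∣p)

module _ {p : ℕ} (p-prime : Prime p) where

  private instance
    p≢0 : NonZero p
    p≢0 = prime⇒nonZero p-prime

  1<p : 1 < p
  1<p = nonTrivial⇒n>1 p {{prime⇒nonTrivial p-prime}}

  p^≢0 : ∀ i → NonZero (p ^ i)
  p^≢0 i = ℕP.m^n≢0 p i

  p^-injective : ∀ {i j} → p ^ i ≡ p ^ j → i ≡ j
  p^-injective {i} {j} p^i≡p^j with ℕP.<-cmp i j
  ... | tri< i<j _ _ = ⊥-elim (ℕP.<-irrefl p^i≡p^j (ℕP.^-monoʳ-< p 1<p i<j))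
  ... | tri≈ _ i≡j _ = i≡j
  ... | tri> _ _ j<i = ⊥-elim (ℕP.<-irrefl (sym p^i≡p^j) (ℕP.^-monoʳ-< p 1<p j<i))

  p^i*p^[m∸i]≡p^m : ∀ {i m} → i ≤ m → p ^ i ℕ.* p ^ (m ∸ i) ≡ p ^ m
  p^i*p^[m∸i]≡p^m {i} {m} i≤m =
    trans (sym (ℕP.^-distribˡ-+-* p i (m ∸ i))) (cong (p ^_) (ℕP.m+[n∸m]≡n i≤m))

  p^i∣p^m : ∀ {i m} → i ≤ m → p ^ i ∣ p ^ m
  p^i∣p^m {i} {m} i≤m = subst (p ^ i ∣_) (p^i*p^[m∸i]≡p^m i≤m) (m∣m*n (p ^ (m ∸ i)))

  suc[pred[p^i]]≡p^i : ∀ i → suc (pred (p ^ i)) ≡ p ^ i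
  suc[pred[p^i]]≡p^i i = ℕP.suc-pred (p ^ i) {{p^≢0 i}}

  pred[p^i]<p^m : ∀ {i m} → i ≤ m → pred (p ^ i) < p ^ m
  pred[p^i]<p^m {i} i≤m = subst (_≤ _) (sym (suc[pred[p^i]]≡p^i i)) (ℕP.^-monoʳ-≤ p i≤m)

  p∤⇒coprime : ∀ {d} → ¬ p ∣ d → Coprime d p
  p∤⇒coprime p∤d (c∣d , c∣p) with prime⇒irreducible p-prime c∣p
  ... | inj₁ c≡1 = c≡1
  ... | inj₂ refl = ⊥-elim (p∤d c∣d)

  ∣p^m⇒≡p^i : ∀ m {d} → d ∣ p ^ m → ∃[ i ] i ≤ m × d ≡ p ^ i
  ∣p^m⇒≡p^i zero d∣1 = 0 , z≤n , ∣1⇒≡1 d∣1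
  ∣p^m⇒≡p^i (suc m) {d} d∣p^[1+m] with p ∣? d
  ... | yes (divides q refl) with ∣p^m⇒≡p^i m (*-cancelˡ-∣ p (subst (_∣ p ^ suc m) (ℕP.*-comm q p) d∣p^[1+m]))
  ...   | i , i≤m , q≡p^i = suc i , s≤s i≤m , trans (ℕP.*-comm q p) (cong (p ℕ.*_) q≡p^i)
  ∣p^m⇒≡p^i (suc m) d∣p^[1+m] | no p∤d with ∣p^m⇒≡p^i m (coprime-divisor (p∤⇒coprime p∤d) d∣p^[1+m])
  ...   | i , i≤m , d≡p^i = i , ℕP.m≤n⇒m≤1+n i≤m , d≡p^i

  -- Row d vanishes unless d + 1 = p ^ i₀ with i₀ ≤ m, and then both sides are the term for i₀.
  sumPairs-p^-row : ∀ m (f : ℕ → ℕ → ℤ) d →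
    ∑ (p ^ m) (λ e → if (suc d ℕ.* suc e) ≡ᵇ p ^ m then f (suc d) (suc e) else + 0)
      ≡ ∑ (suc m) (λ i → if p ^ i ≡ᵇ suc d then f (p ^ i) (p ^ (m ∸ i)) else + 0)
  sumPairs-p^-row m f d with suc d ∣? p ^ m
  ... | no d+1∤p^m = trans
    (∑-if-none (p ^ m) (λ e → (suc d ℕ.* suc e) ≡ᵇ p ^ m) (f (suc d) ∘ suc)
      (λ e _ de≡ → d+1∤p^m (subst (suc d ∣_) (≡ᵇ⇒≡ _ _ de≡) (m∣m*n (suc e)))))
    (sym (∑-if-none (suc m) (λ i → p ^ i ≡ᵇ suc d) (λ i → f (p ^ i) (p ^ (m ∸ i)))
      (λ i i≤m p^i≡ → d+1∤p^m (subst (_∣ p ^ m) (≡ᵇ⇒≡ _ _ p^i≡) (p^i∣p^m (ℕP.≤-pred i≤m))))))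
  ... | yes d+1∣p^m with ∣p^m⇒≡p^i m d+1∣p^m
  ...   | i₀ , i₀≤m , d+1≡p^i₀ = begin
    ∑ (p ^ m) (λ e → if (suc d ℕ.* suc e) ≡ᵇ p ^ m then f (suc d) (suc e) else + 0)
      ≡⟨ ∑-if-unique (p ^ m) (λ e → (suc d ℕ.* suc e) ≡ᵇ p ^ m) (f (suc d) ∘ suc)
           (pred[p^i]<p^m (ℕP.m∸n≤m m i₀)) (≡⇒≡ᵇ _ _ product-at-e₀) unique-e₀ ⟩
    f (suc d) (suc e₀)
      ≡⟨ cong₂ f d+1≡p^i₀ (suc[pred[p^i]]≡p^i (m ∸ i₀)) ⟩
    f (p ^ i₀) (p ^ (m ∸ i₀))
      ≡⟨ ∑-if-unique (suc m) (λ i → p ^ i ≡ᵇ suc d) (λ i → f (p ^ i) (p ^ (m ∸ i)))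
           (s≤s i₀≤m) (≡⇒≡ᵇ _ _ (sym d+1≡p^i₀))
           (λ i p^i≡ → p^-injective (trans (≡ᵇ⇒≡ _ _ p^i≡) d+1≡p^i₀)) ⟨
    ∑ (suc m) (λ i → if p ^ i ≡ᵇ suc d then f (p ^ i) (p ^ (m ∸ i)) else + 0)
      ∎
    where
    open ≡-Reasoning
    e₀ : ℕ
    e₀ = pred (p ^ (m ∸ i₀))
    product-at-e₀ : suc d ℕ.* suc e₀ ≡ p ^ m
    product-at-e₀ = trans (cong₂ ℕ._*_ d+1≡p^i₀ (suc[pred[p^i]]≡p^i (m ∸ i₀))) (p^i*p^[m∸i]≡p^m i₀≤m)
    unique-e₀ : ∀ e → T ((suc d ℕ.* suc e) ≡ᵇ p ^ m) → e ≡ e₀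
    unique-e₀ e de≡ =
      cong pred (ℕP.*-cancelˡ-≡ (suc e) (suc e₀) (suc d) (trans (≡ᵇ⇒≡ _ _ de≡) (sym product-at-e₀)))

  sumPairs-p^ : ∀ m (f : ℕ → ℕ → ℤ) → sumPairs (p ^ m) f ≡ ∑ (suc m) (λ i → f (p ^ i) (p ^ (m ∸ i)))
  sumPairs-p^ m f = begin
    sumPairs (p ^ m) f
      ≡⟨ sumPairs-∑∑ (p ^ m) f ⟩
    ∑ (p ^ m) (λ d → ∑ (p ^ m) (λ e → if (suc d ℕ.* suc e) ≡ᵇ p ^ m then f (suc d) (suc e) else + 0))
      ≡⟨ ∑-cong (p ^ m) (λ d _ → sumPairs-p^-row m f d) ⟩
    ∑ (p ^ m) (λ d → ∑ (suc m) (λ i → if p ^ i ≡ᵇ suc d then f (p ^ i) (p ^ (m ∸ i)) else + 0))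
      ≡⟨ ∑-swap (p ^ m) (suc m) (λ d i → if p ^ i ≡ᵇ suc d then f (p ^ i) (p ^ (m ∸ i)) else + 0) ⟩
    ∑ (suc m) (λ i → ∑ (p ^ m) (λ d → if p ^ i ≡ᵇ suc d then f (p ^ i) (p ^ (m ∸ i)) else + 0))
      ≡⟨ ∑-cong (suc m) (λ i i≤m → column i (ℕP.≤-pred i≤m)) ⟩
    ∑ (suc m) (λ i → f (p ^ i) (p ^ (m ∸ i)))
      ∎
    where
    open ≡-Reasoning
    column : ∀ i → i ≤ m →
      ∑ (p ^ m) (λ d → if p ^ i ≡ᵇ suc d then f (p ^ i) (p ^ (m ∸ i)) else + 0) ≡ f (p ^ i) (p ^ (m ∸ i))
    column i i≤m = ∑-if-unique (p ^ m) (λ d → p ^ i ≡ᵇ suc d) (λ _ → f (p ^ i) (p ^ (m ∸ i)))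
      (pred[p^i]<p^m i≤m) (≡⇒≡ᵇ _ _ (sym (suc[pred[p^i]]≡p^i i)))
      (λ d p^i≡ → cong pred (sym (≡ᵇ⇒≡ (p ^ i) (suc d) p^i≡)))

  μ-p^1 : μ (p ^ 1) ≡ - + 1
  μ-p^1 = trans (cong μ (ℕP.*-identityʳ p)) (μ-prime p-prime)

  μ-p^[2+l] : ∀ l → μ (p ^ suc (suc l)) ≡ + 0
  μ-p^[2+l] l = μ-non-squarefree {{p^≢0 (suc (suc l))}} p-prime p²∣p^[2+l]
    where
    p²∣p^[2+l] : p ℕ.* p ∣ p ^ suc (suc l)
    p²∣p^[2+l] = divides (p ^ l) (trans (sym (ℕP.*-assoc p p (p ^ l))) (ℕP.*-comm (p ℕ.* p) (p ^ l)))

  -- Only g = 1 and g = p contribute to Σ_{g ∣ p^i} μ(g) (p^i/g)^j.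
  primFactor-p^ : ∀ j → (λ i → primFactor j (p ^ i)) ≗ Δ (λ i → + ((p ^ i) ^ j))
  primFactor-p^ j zero =
    trans (sumPairs-p^ 0 (λ g e → μ g * + (e ^ j))) (trans (ℤP.+-identityʳ _) (ℤP.*-identityˡ (+ (1 ^ j))))
  primFactor-p^ j (suc k) = begin
    primFactor j (p ^ suc k)
      ≡⟨ sumPairs-p^ (suc k) (λ g e → μ g * + (e ^ j)) ⟩
    + 1 * A + (μ (p ^ 1) * B + ∑ k (λ l → μ (p ^ suc (suc l)) * + ((p ^ (k ∸ suc l)) ^ j)))
      ≡⟨ cong₂ (λ μp rest → + 1 * A + (μp * B + rest)) μ-p^1 (∑-zero k (λ l _ → vanishes l)) ⟩
    + 1 * A + (- + 1 * B + + 0)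
      ≡⟨ simplify A B ⟩
    A - B
      ∎
    where
    open ≡-Reasoning
    A B : ℤ
    A = + ((p ^ suc k) ^ j)
    B = + ((p ^ k) ^ j)
    simplify : ∀ a b → + 1 * a + (- + 1 * b + + 0) ≡ a - b
    simplify = solve-∀
    vanishes : ∀ l → μ (p ^ suc (suc l)) * + ((p ^ (k ∸ suc l)) ^ j) ≡ + 0
    vanishes l = trans (cong (_* + ((p ^ (k ∸ suc l)) ^ j)) (μ-p^[2+l] l)) (ℤP.*-zeroˡ (+ ((p ^ (k ∸ suc l)) ^ j)))

  sumTuples-p^ : ∀ F j n → (λ m → sumTuples F j (suc n) (p ^ m))
                              ≗ (λ i → F j (p ^ i)) ⋆ (λ m → sumTuples F (suc j) n (p ^ m))
  sumTuples-p^ F j n m = sumPairs-p^ m (λ d e → F j d * sumTuples F (suc j) n e)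

  sumTuples-primFactor-p^ : ∀ n j → (λ m → sumTuples primFactor j n (p ^ m))
                                       ≗ Δ^ n (λ m → sumTuples (λ j d → + (d ^ j)) j n (p ^ m))
  sumTuples-primFactor-p^ zero j m = refl
  sumTuples-primFactor-p^ (suc n) j m = begin
    sumTuples primFactor j (suc n) (p ^ m)
      ≡⟨ sumTuples-p^ primFactor j n m ⟩
    ((λ i → primFactor j (p ^ i)) ⋆ (λ m → sumTuples primFactor (suc j) n (p ^ m))) m
      ≡⟨ ⋆-cong (primFactor-p^ j) (sumTuples-primFactor-p^ n (suc j)) m ⟩
    (Δ powers ⋆ Δ^ n (tuples (suc j) n)) m
      ≡⟨ Δ-⋆ˡ powers (Δ^ n (tuples (suc j) n)) m ⟩
    Δ (powers ⋆ Δ^ n (tuples (suc j) n)) m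
      ≡⟨ Δ-cong (Δ^-⋆ʳ n powers (tuples (suc j) n)) m ⟩
    Δ (Δ^ n (powers ⋆ tuples (suc j) n)) m
      ≡⟨ Δ-cong (Δ^-cong n (λ m → sym (sumTuples-p^ (λ j d → + (d ^ j)) j n m))) m ⟩
    Δ (Δ^ n (tuples j (suc n))) m
      ∎
    where
    open ≡-Reasoning
    powers : ℕ → ℤ
    powers i = + ((p ^ i) ^ j)
    tuples : ℕ → ℕ → ℕ → ℤ
    tuples j n m = sumTuples (λ j d → + (d ^ j)) j n (p ^ m)

lemma12 : (n p m : ℕ) → 2 ≤ n → Prime p →
    a' n (p ^ m) ≡ sumℤ (map (λ i → ((- + 1) Data.Integer.^ i) * (+ (n C i)) * a n (p ^ (m ∸ i))) (upTo (suc m)))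
lemma12 n p m _ p-prime = begin
  a' n (p ^ m)                                ≡⟨ sumTuples-primFactor-p^ p-prime n 0 m ⟩
  Δ^ n (λ k → a n (p ^ k)) m                  ≡⟨ Δ^≗signedBinomial-⋆ n (λ k → a n (p ^ k)) m ⟩
  (signedBinomial n ⋆ (λ k → a n (p ^ k))) m  ≡⟨ sumℤ-map-upTo (λ i → signedBinomial n i * a n (p ^ (m ∸ i))) (suc m) ⟨
  sumℤ (map (λ i → signedBinomial n i * a n (p ^ (m ∸ i))) (upTo (suc m)))  ∎
  where open ≡-Reasoning
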